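{- Let $n\geq 2$ and $v\geq 2$ be integers and let $\Gamma(n,v)$ be the graph defined below. Then every $v$-clique of $\Gamma(n,v)$ contains precisely one vertex of the form $(i,j)$ for every $j\in\{0,1,\ldots,v-1\}$.
   Context: The graph $\Gamma(n,v)$ has vertex set $\{(i,j):0\leq i\leq n-1,\ 0\leq j\leq v-1\}$, and $(i,j)$ is adjacent to $(k,\ell)$ if and only if one of the following holds: (1) $i=k$ and $j\neq \ell$; (2) $i<k$ and $\ell-j\not\equiv 0$ and $\ell-j\not\equiv 1 \pmod v$; (3) $i>k$ and $j-\ell\not\equiv 0$ and $j-\ell\not\equiv 1\pmod v$. A $v$-clique is a set of $v$ pairwise adjacent vertices. -}

module Defs where

open import Data.Nat using (ℕ)
open import Data.Integer using (ℤ; +_; _-_)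
open import Data.Integer.Divisibility using (_∣_)
open import Data.Fin using (Fin; toℕ)
open import Data.Product using (_×_; _,_)
open import Data.Sum using (_⊎_)
open import Relation.Nullary using (¬_)
open import Relation.Binary.PropositionalEquality using (_≡_; _≢_)
open import Data.Nat using (_<_)

Vertex : ℕ → ℕ → Set
Vertex n v = Fin n × Fin v

_≡[mod_]_ : ℤ → ℕ → ℤ → Set
a ≡[mod v ] b = (+ v) ∣ (a - b)

Good : ∀ {v} → Fin v → Fin v → Set
Good {v} y x =
  ¬ ((+ toℕ x - + toℕ y) ≡[mod v ] (+ 0)) × ¬ ((+ toℕ x - + toℕ y) ≡[mod v ] (+ 1))

Adj : ∀ {n v} → Vertex n v → Vertex n v → Set
Adj (i , j) (k , ℓ) =
    (i ≡ k × j ≢ ℓ)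
  ⊎ ((toℕ i < toℕ k) × Good j ℓ)
  ⊎ ((toℕ k < toℕ i) × Good ℓ j)

IsClique : ∀ {n v} → (m : ℕ) → (Fin m → Vertex n v) → Set
IsClique m c = ∀ (a b : Fin m) → a ≢ b → (c a ≢ c b) × Adj (c a) (c b)

-- Two vertices in the same column j are never adjacent: rule (1) needs distinct
-- columns, and rules (2), (3) exclude a column difference ≡ 0 (mod v). Hence the
-- column map of a v-clique is an injection Fin v → Fin v, and an injective
-- endomap of a finite set is a bijection.
module Submission where

open import Defs
open import Data.Nat using (ℕ; suc; _≥_)
open import Data.Nat.Properties using (<-irrefl)
open import Data.Nat.Divisibility using (_∣0)
open import Data.Integer using (ℤ; +_)
open import Data.Integer.Divisibility using (_∣_)
open import Data.Integer.Properties using (+-inverseʳ)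
open import Data.Fin using (Fin; toℕ; punchOut)
open import Data.Fin.Properties using (any?; injective⇒≤; punchOut-injective) renaming (_≟_ to _≟ᶠ_)
open import Data.Product using (∃; ∃-syntax; _×_; _,_; proj₂)
open import Data.Sum using (inj₁; inj₂)
open import Function.Base using (_∘_)
open import Function.Definitions using (Injective)
open import Relation.Nullary using (¬_; yes; no; contradiction)
open import Relation.Binary.PropositionalEquality using (_≡_; _≢_; refl; sym; trans; subst)

≡⇒≡[mod] : ∀ {v} {a b : ℤ} → a ≡ b → a ≡[mod v ] b
≡⇒≡[mod] {v} {a} refl = subst (λ d → + v ∣ d) (sym (+-inverseʳ a)) (v ∣0)

Good-irrefl : ∀ {v} (x : Fin v) → ¬ Good x x
Good-irrefl x (x-x≢0 , _) = x-x≢0 (≡⇒≡[mod] (+-inverseʳ (+ toℕ x)))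

¬Adj-sameColumn : ∀ {n v} (p q : Vertex n v) → proj₂ p ≡ proj₂ q → ¬ Adj p q
¬Adj-sameColumn (_ , j) (_ , .j) refl (inj₁ (_ , j≢j))        = j≢j refl
¬Adj-sameColumn (_ , j) (_ , .j) refl (inj₂ (inj₁ (_ , good))) = Good-irrefl j good
¬Adj-sameColumn (_ , j) (_ , .j) refl (inj₂ (inj₂ (_ , good))) = Good-irrefl j good

clique-column-injective : ∀ {n v m} {c : Fin m → Vertex n v} →
                          IsClique m c → Injective _≡_ _≡_ (proj₂ ∘ c)
clique-column-injective {c = c} clique {a} {b} same with a ≟ᶠ b
... | yes a≡b = a≡b
... | no  a≢b = contradiction (proj₂ (clique a b a≢b)) (¬Adj-sameColumn (c a) (c b) same)

-- If j were missed, punching j out of f would inject Fin (suc m) into Fin m.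
injective⇒surjective : ∀ {m} {f : Fin m → Fin m} → Injective _≡_ _≡_ f →
                       ∀ j → ∃ λ a → f a ≡ j
injective⇒surjective {suc m} {f} f-inj j with any? (λ a → f a ≟ᶠ j)
... | yes hit  = hit
... | no  miss = contradiction (injective⇒≤ punched-injective) (<-irrefl refl)
  where
  j≢f : ∀ a → j ≢ f a
  j≢f a j≡fa = miss (a , sym j≡fa)

  punched : Fin (suc m) → Fin m
  punched a = punchOut (j≢f a)

  punched-injective : Injective _≡_ _≡_ punched
  punched-injective {a} {b} = f-inj ∘ punchOut-injective (j≢f a) (j≢f b)

lemma2p2 : (n v : ℕ) → n ≥ 2 → v ≥ 2 →
           (c : Fin v → Vertex n v) → IsClique v c →
           (j : Fin v) →
             ∃[ a ] (proj₂ (c a) ≡ j × (∀ b → proj₂ (c b) ≡ j → b ≡ a))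
lemma2p2 _ _ _ _ c clique j =
  let a , ca≡j = injective⇒surjective column-injective j
  in  a , ca≡j , λ b cb≡j → column-injective (trans cb≡j (sym ca≡j))
  where
  column-injective : Injective _≡_ _≡_ (proj₂ ∘ c)
  column-injective = clique-column-injective clique
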